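{- For all integers $m,n\geq 3$, let $T_{m,n}=C_m\Box C_n$. Then $\chi_i(T_{m,n})=5$ if $m\equiv 0 \pmod 5$ and $n\equiv 0\pmod 5$, and $\chi_i(T_{m,n})=6$ otherwise.
   Context: All graphs are finite and simple. For a graph $G$, an incidence is a pair $(v,e)$ with $v\in V(G)$, $e\in E(G)$ and $v$ incident with $e$. Two incidences $(v,e)$ and $(w,f)$ are adjacent if $v=w$, or $e=f$, or the edge $vw$ equals $e$ or $f$. An incidence $k$-coloring of $G$ is a map from the set of incidences of $G$ to a set of $k$ colors such that adjacent incidences receive distinct colors; the incidence chromatic number $\chi_i(G)$ is the least $k$ for which $G$ has an incidence $k$-coloring. $C_n$ denotes the cycle on $n$ vertices. The Cartesian product $G\Box H$ has vertex set $V(G)\times V(H)$, with $(u_1,v_1)$ adjacent to $(u_2,v_2)$ iff either $u_1=u_2$ and $v_1v_2\in E(H)$, or $v_1=v_2$ and $u_1u_2\in E(G)$. -}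

module Defs where

open import Level using (0ℓ)
open import Data.Nat using (ℕ; suc; _<_)
open import Data.Fin using (Fin; toℕ)
open import Data.Product using (Σ; _×_; _,_; proj₁; proj₂)
open import Data.Sum using (_⊎_)
open import Relation.Binary.PropositionalEquality using (_≡_)
open import Relation.Nullary using (¬_)

-- A graph given by a vertex type and an adjacency relation (the instances
-- used below, C_m □ C_n with m,n ≥ 3, are symmetric and irreflexive).
record Graph : Set₁ where
  field
    V   : Set
    Adj : V → V → Set

open Graph public

Succ : (m : ℕ) → Fin m → Fin m → Set
Succ m i j = (suc (toℕ i) ≡ toℕ j) ⊎ (suc (toℕ i) ≡ m × toℕ j ≡ 0)

CycAdj : (m : ℕ) → Fin m → Fin m → Set
CycAdj m i j = Succ m i j ⊎ Succ m j i

BoxAdj : {A B : Set} → (A → A → Set) → (B → B → Set) → A × B → A × B → Set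
BoxAdj R S (u₁ , v₁) (u₂ , v₂) = (u₁ ≡ u₂ × S v₁ v₂) ⊎ (v₁ ≡ v₂ × R u₁ u₂)

SameEdge : {A : Set} → A × A → A × A → Set
SameEdge (a , b) (c , d) = (a ≡ c × b ≡ d) ⊎ (a ≡ d × b ≡ c)

module _ (G : Graph) where
  -- an incidence (v, e) with e = vw is represented by the ordered pair (v , w)
  Incidence : Set
  Incidence = Σ (V G × V G) λ p → Adj G (proj₁ p) (proj₂ p)

  vert : Incidence → V G
  vert ((v , _) , _) = v

  edge : Incidence → V G × V G
  edge ((v , w) , _) = (v , w)

  IncAdj : Incidence → Incidence → Set
  IncAdj i j =
      vert i ≡ vert j
    ⊎ SameEdge (edge i) (edge j)
    ⊎ SameEdge (vert i , vert j) (edge i)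
    ⊎ SameEdge (vert i , vert j) (edge j)

  DistinctInc : Incidence → Incidence → Set
  DistinctInc i j = ¬ (vert i ≡ vert j × SameEdge (edge i) (edge j))

  IncidenceColoring : ℕ → Set
  IncidenceColoring k = Σ (Incidence → Fin k) λ c →
    ∀ i j → DistinctInc i j → IncAdj i j → ¬ (c i ≡ c j)

  IncChromaticNumber : ℕ → Set
  IncChromaticNumber k = IncidenceColoring k × (∀ j → j < k → ¬ IncidenceColoring j)

Cycle : ℕ → Graph
Cycle m = record { V = Fin m ; Adj = CycAdj m }

_□_ : Graph → Graph → Graph
G □ H = record { V = V G × V H ; Adj = BoxAdj (Adj G) (Adj H) }

Torus : ℕ → ℕ → Graph
Torus m n = Cycle m □ Cycle n

module Submission where

-- An incidence (w, wu) is adjacent to the four incidences at u, so at least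
-- five colours are needed.  In an incidence 5-colouring every incidence
-- entering u therefore has the single colour missing at u; this missing colour
-- makes every closed neighbourhood of the torus rainbow, i.e. each colour class
-- is a perfect code.  Forcing where a colour must reappear in nearby closed
-- neighbourhoods shows that such a colouring has period exactly 5 along every
-- row and column, so 5 divides m and n.  Conversely, the perfect code
-- x + 2y mod 5 of C₅ □ C₅ lifts to a 5-colouring when 5 divides m and n, and
-- a 6-colouring of every torus is glued from tiles along closed walks of
-- lengths 3, 4 and 5.

open import Defs
open import Data.Bool using (Bool; true; false; T)
open import Data.Empty using (⊥-elim)
open import Data.Fin using (Fin; zero; suc; toℕ; fromℕ; fromℕ<; inject₁; _≟_; #_)
open import Data.Fin.Patterns using (0F; 1F; 2F; 3F; 4F)
open import Data.Fin.Properties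
  using (toℕ-fromℕ; toℕ-fromℕ<; toℕ-inject₁; toℕ-injective; toℕ<n; injective⇒≤; all?)
open import Data.Nat using (ℕ; zero; suc; _+_; _*_; _≤_; _<_; _%_; _/_; s≤s; _<?_; NonZero)
open import Data.Nat.DivMod
  using ( _mod_; m≡m%n+[m/n]*n; m%n<n; m*n%n≡0; m<n⇒m%n≡m; n%n≡0; %-distribˡ-+; m%n%n≡m%n
        ; [m+n]%n≡m%n)
open import Data.Nat.Properties
  using ( suc-injective; ≤∧≮⇒≡; 1+n≰n; 1+n≢n; m≢1+n+m; <-irrefl; ≤-trans; n≤1+n
        ; +-identityʳ; +-suc; +-comm; <⇒≱; m<1+n⇒m<n∨m≡n)
open import Data.Nat.GeneralisedArithmetic using (fold; fold-+)
open import Data.Product using (∃; _×_; _,_; proj₁; proj₂; swap)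
open import Data.Sum using (inj₁; inj₂)
open import Data.Vec using (Vec; []; _∷_; lookup)
open import Data.Vec.Membership.Propositional using (_∈_; _∉_)
open import Data.Vec.Relation.Unary.All using (All; []; _∷_)
import Data.Vec.Relation.Unary.All as All
open import Data.Vec.Relation.Unary.AllPairs using ([]; _∷_)
open import Data.Vec.Relation.Unary.Any using (here; there; any?)
open import Data.Vec.Relation.Unary.Unique.Propositional using (Unique)
open import Data.Vec.Relation.Unary.Unique.Propositional.Properties using (lookup-injective)
open import Function.Base using (_∘_; case_of_)
open import Relation.Binary.PropositionalEquality
open import Relation.Nullary using (¬_; Dec; yes; no; contradiction)
open import Relation.Nullary.Decidable using (⌊_⌋; fromWitness; from-yes; _×-dec_; _→-dec_; ¬?; T?)

private
  variable
    k m n : ℕ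

∉⇒All≢ : ∀ {a} {A : Set a} {x : A} {xs : Vec A n} → x ∉ xs → All (x ≢_) xs
∉⇒All≢ {xs = []}     _   = []
∉⇒All≢ {xs = _ ∷ _} x∉ = (x∉ ∘ here) ∷ ∉⇒All≢ (x∉ ∘ there)

unique⇒length≤ : {xs : Vec (Fin k) n} → Unique xs → n ≤ k
unique⇒length≤ xs! = injective⇒≤ (λ {i} {j} → lookup-injective xs! i j)

unique⇒∈ : {xs : Vec (Fin n) n} → Unique xs → ∀ x → x ∈ xs
unique⇒∈ {xs = xs} xs! x with any? (x ≟_) xs
... | yes x∈xs = x∈xs
... | no  x∉xs = contradiction (unique⇒length≤ (∉⇒All≢ x∉xs ∷ xs!)) 1+n≰n

unique-transpose : ∀ {a} {A : Set a} {u v w x y : A} →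
  Unique (u ∷ v ∷ w ∷ x ∷ y ∷ []) → Unique (u ∷ x ∷ y ∷ v ∷ w ∷ [])
unique-transpose ((uv ∷ uw ∷ ux ∷ uy ∷ []) ∷ (vw ∷ vx ∷ vy ∷ []) ∷ (wx ∷ wy ∷ []) ∷ (xy ∷ []) ∷ [] ∷ []) =
  (ux ∷ uy ∷ uv ∷ uw ∷ []) ∷ (xy ∷ ≢-sym vx ∷ ≢-sym wx ∷ []) ∷ (≢-sym vy ∷ ≢-sym wy ∷ []) ∷ (vw ∷ []) ∷ [] ∷ []

-- Cycles

next : Fin m → Fin m
next {suc m} i with suc (toℕ i) <? suc m
... | yes i+1<m = fromℕ< i+1<m
... | no  _     = zero

prev : Fin m → Fin m
prev {suc m} zero    = fromℕ m
prev {suc m} (suc i) = inject₁ i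

Succ-next : (i : Fin m) → Succ m i (next i)
Succ-next {suc m} i with suc (toℕ i) <? suc m
... | yes i+1<m = inj₁ (sym (toℕ-fromℕ< i+1<m))
... | no  i+1≮m = inj₂ (≤∧≮⇒≡ (toℕ<n i) i+1≮m , refl)

Succ-prev : (i : Fin m) → Succ m (prev i) i
Succ-prev {suc m} zero    = inj₂ (cong suc (toℕ-fromℕ m) , refl)
Succ-prev {suc m} (suc i) = inj₁ (cong suc (toℕ-inject₁ i))

m≢toℕ : (j : Fin m) → m ≢ toℕ j
m≢toℕ j m≡j = <-irrefl (sym m≡j) (toℕ<n j)

Succ-functional : {i j j′ : Fin m} → Succ m i j → Succ m i j′ → j ≡ j′
Succ-functional (inj₁ p)       (inj₁ q)       = toℕ-injective (trans (sym p) q)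
Succ-functional (inj₁ p)       (inj₂ (q , _)) = ⊥-elim (m≢toℕ _ (trans (sym q) p))
Succ-functional (inj₂ (p , _)) (inj₁ q)       = ⊥-elim (m≢toℕ _ (trans (sym p) q))
Succ-functional (inj₂ (_ , p)) (inj₂ (_ , q)) = toℕ-injective (trans p (sym q))

Succ-injective : {i i′ j : Fin m} → Succ m i j → Succ m i′ j → i ≡ i′
Succ-injective (inj₁ p)       (inj₁ q)       = toℕ-injective (suc-injective (trans p (sym q)))
Succ-injective (inj₁ p)       (inj₂ (_ , q)) = contradiction (trans p q) λ ()
Succ-injective (inj₂ (_ , p)) (inj₁ q)       = contradiction (trans q p) λ ()
Succ-injective (inj₂ (p , _)) (inj₂ (q , _)) = toℕ-injective (suc-injective (trans p (sym q)))

prev-next : (i : Fin m) → prev (next i) ≡ i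
prev-next i = Succ-injective (Succ-prev (next i)) (Succ-next i)

next-prev : (i : Fin m) → next (prev i) ≡ i
next-prev i = Succ-functional (Succ-next (prev i)) (Succ-prev i)

Succ-irreflexive : 2 ≤ m → {i : Fin m} → ¬ Succ m i i
Succ-irreflexive _   (inj₁ p)       = 1+n≢n p
Succ-irreflexive 2≤m (inj₂ (p , q)) = contradiction (subst (2 ≤_) (trans (sym p) (cong suc q)) 2≤m) λ { (s≤s ()) }

Succ-asymmetric : 3 ≤ m → {i j : Fin m} → Succ m i j → ¬ Succ m j i
Succ-asymmetric _   {i} (inj₁ p) (inj₁ q) = m≢1+n+m (toℕ i) (sym (trans (cong suc p) q))
Succ-asymmetric 3≤m (inj₁ p) (inj₂ (q , r)) =
  contradiction (subst (3 ≤_) (trans (sym q) (cong suc (trans (sym p) (cong suc r)))) 3≤m) λ { (s≤s (s≤s ())) }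
Succ-asymmetric 3≤m (inj₂ (q , r)) (inj₁ p) =
  contradiction (subst (3 ≤_) (trans (sym q) (cong suc (trans (sym p) (cong suc r)))) 3≤m) λ { (s≤s (s≤s ())) }
Succ-asymmetric 3≤m (inj₂ (_ , r)) (inj₂ (q , _)) =
  contradiction (subst (3 ≤_) (trans (sym q) (cong suc r)) 3≤m) λ { (s≤s ()) }

next-irreflexive : 2 ≤ m → (i : Fin m) → next i ≢ i
next-irreflexive 2≤m i e = Succ-irreflexive 2≤m (subst (Succ _ i) e (Succ-next i))

prev-irreflexive : 2 ≤ m → (i : Fin m) → prev i ≢ i
prev-irreflexive 2≤m i e = Succ-irreflexive 2≤m (subst (λ j → Succ _ j i) e (Succ-prev i))

next≢prev : 3 ≤ m → (i : Fin m) → next i ≢ prev i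
next≢prev 3≤m i e = Succ-asymmetric 3≤m (Succ-next i) (subst (λ j → Succ _ j i) (sym e) (Succ-prev i))

toℕ-next : .{{_ : NonZero m}} (i : Fin m) → toℕ (next i) ≡ suc (toℕ i) % m
toℕ-next {suc m} i with suc (toℕ i) <? suc m
... | yes i+1<m = trans (toℕ-fromℕ< i+1<m) (sym (m<n⇒m%n≡m i+1<m))
... | no  i+1≮m = trans (sym (n%n≡0 (suc m))) (cong (_% suc m) (sym (≤∧≮⇒≡ (toℕ<n i) i+1≮m)))

suc-%-absorb : ∀ a d .{{_ : NonZero d}} → suc (a % d) % d ≡ suc a % d
suc-%-absorb a d = begin
  (1 + a % d) % d           ≡⟨ %-distribˡ-+ 1 (a % d) d ⟩
  (1 % d + a % d % d) % d   ≡⟨ cong (λ t → (1 % d + t) % d) (m%n%n≡m%n a d) ⟩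
  (1 % d + a % d) % d       ≡⟨ %-distribˡ-+ 1 a d ⟨
  (1 + a) % d               ∎
  where open ≡-Reasoning

toℕ-fold-next : ∀ (i : Fin (suc m)) t → toℕ (fold i next t) ≡ (toℕ i + t) % suc m
toℕ-fold-next {m} i zero    = sym (trans (cong (_% suc m) (+-identityʳ (toℕ i))) (m<n⇒m%n≡m (toℕ<n i)))
toℕ-fold-next {m} i (suc t) = begin
  toℕ (next (fold i next t))       ≡⟨ toℕ-next (fold i next t) ⟩
  suc (toℕ (fold i next t)) % suc m ≡⟨ cong (λ a → suc a % suc m) (toℕ-fold-next i t) ⟩
  suc ((toℕ i + t) % suc m) % suc m ≡⟨ suc-%-absorb (toℕ i + t) (suc m) ⟩
  suc (toℕ i + t) % suc m           ≡⟨ cong (_% suc m) (+-suc (toℕ i) t) ⟨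
  (toℕ i + suc t) % suc m           ∎
  where open ≡-Reasoning

fold-next-length : (i : Fin m) → fold i next m ≡ i
fold-next-length {suc m} i = toℕ-injective (begin
  toℕ (fold i next (suc m)) ≡⟨ toℕ-fold-next i (suc m) ⟩
  (toℕ i + suc m) % suc m   ≡⟨ [m+n]%n≡m%n (toℕ i) (suc m) ⟩
  toℕ i % suc m             ≡⟨ m<n⇒m%n≡m (toℕ<n i) ⟩
  toℕ i                     ∎)
  where open ≡-Reasoning

-- The torus

Dir : Set
Dir = Fin 4

pattern E = 0F
pattern W = 1F
pattern N = 2F
pattern S = 3F

step : Dir → Fin m × Fin n → Fin m × Fin n
step E (x , y) = next x , y
step W (x , y) = prev x , y
step N (x , y) = x , next y
step S (x , y) = x , prev y

step-W-E : (v : Fin m × Fin n) → step W (step E v) ≡ v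
step-W-E (x , y) = cong (_, y) (prev-next x)

step-E-W : (v : Fin m × Fin n) → step E (step W v) ≡ v
step-E-W (x , y) = cong (_, y) (next-prev x)

step-S-N : (v : Fin m × Fin n) → step S (step N v) ≡ v
step-S-N (x , y) = cong (x ,_) (prev-next y)

step-N-S : (v : Fin m × Fin n) → step N (step S v) ≡ v
step-N-S (x , y) = cong (x ,_) (next-prev y)

step-adjacent : ∀ d (v : Fin m × Fin n) → Adj (Torus m n) v (step d v)
step-adjacent E (x , y) = inj₂ (refl , inj₁ (Succ-next x))
step-adjacent W (x , y) = inj₂ (refl , inj₂ (Succ-prev x))
step-adjacent N (x , y) = inj₁ (refl , inj₁ (Succ-next y))
step-adjacent S (x , y) = inj₁ (refl , inj₂ (Succ-prev y))

direction : {v w : Fin m × Fin n} → Adj (Torus m n) v w → Dir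
direction (inj₁ (_ , inj₁ _)) = N
direction (inj₁ (_ , inj₂ _)) = S
direction (inj₂ (_ , inj₁ _)) = E
direction (inj₂ (_ , inj₂ _)) = W

step-direction : {v w : Fin m × Fin n} (v~w : Adj (Torus m n) v w) → w ≡ step (direction v~w) v
step-direction (inj₁ (x≡x′ , inj₁ y→y′)) = cong₂ _,_ (sym x≡x′) (Succ-functional y→y′ (Succ-next _))
step-direction (inj₁ (x≡x′ , inj₂ y′→y)) = cong₂ _,_ (sym x≡x′) (Succ-injective y′→y (Succ-prev _))
step-direction (inj₂ (y≡y′ , inj₁ x→x′)) = cong₂ _,_ (Succ-functional x→x′ (Succ-next _)) (sym y≡y′)
step-direction (inj₂ (y≡y′ , inj₂ x′→x)) = cong₂ _,_ (Succ-injective x′→x (Succ-prev _)) (sym y≡y′)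

-- An incidence colouring of the torus with the incidence (v, vw) indexed by
-- v and the direction from v to w.
record DirColouring (m n k : ℕ) : Set where
  field
    colour         : Fin m × Fin n → Dir → Fin k
    distinct-at    : ∀ v {d d′} → d ≢ d′ → colour v d ≢ colour v d′
    distinct-along : ∀ v d d′ → colour v d ≢ colour (step d v) d′

module _ (3≤m : 3 ≤ m) (3≤n : 3 ≤ n) where

  private
    2≤m : 2 ≤ m
    2≤m = ≤-trans (n≤1+n 2) 3≤m
    2≤n : 2 ≤ n
    2≤n = ≤-trans (n≤1+n 2) 3≤n

  step-irreflexive : ∀ d (v : Fin m × Fin n) → step d v ≢ v
  step-irreflexive E (x , y) = next-irreflexive 2≤m x ∘ cong proj₁
  step-irreflexive W (x , y) = prev-irreflexive 2≤m x ∘ cong proj₁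
  step-irreflexive N (x , y) = next-irreflexive 2≤n y ∘ cong proj₂
  step-irreflexive S (x , y) = prev-irreflexive 2≤n y ∘ cong proj₂

  step-injective : ∀ d d′ (v : Fin m × Fin n) → step d v ≡ step d′ v → d ≡ d′
  step-injective E E _ _ = refl
  step-injective W W _ _ = refl
  step-injective N N _ _ = refl
  step-injective S S _ _ = refl
  step-injective E W (x , _) e = ⊥-elim (next≢prev 3≤m x (cong proj₁ e))
  step-injective W E (x , _) e = ⊥-elim (next≢prev 3≤m x (cong proj₁ (sym e)))
  step-injective N S (_ , y) e = ⊥-elim (next≢prev 3≤n y (cong proj₂ e))
  step-injective S N (_ , y) e = ⊥-elim (next≢prev 3≤n y (cong proj₂ (sym e)))
  step-injective E N (x , _) e = ⊥-elim (next-irreflexive 2≤m x (cong proj₁ e))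
  step-injective E S (x , _) e = ⊥-elim (next-irreflexive 2≤m x (cong proj₁ e))
  step-injective W N (x , _) e = ⊥-elim (prev-irreflexive 2≤m x (cong proj₁ e))
  step-injective W S (x , _) e = ⊥-elim (prev-irreflexive 2≤m x (cong proj₁ e))
  step-injective N E (x , _) e = ⊥-elim (next-irreflexive 2≤m x (cong proj₁ (sym e)))
  step-injective N W (x , _) e = ⊥-elim (prev-irreflexive 2≤m x (cong proj₁ (sym e)))
  step-injective S E (x , _) e = ⊥-elim (next-irreflexive 2≤m x (cong proj₁ (sym e)))
  step-injective S W (x , _) e = ⊥-elim (prev-irreflexive 2≤m x (cong proj₁ (sym e)))

  fromDirColouring : DirColouring m n k → IncidenceColoring (Torus m n) k
  fromDirColouring {k} D = colourOf , proper
    where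
    open DirColouring D
    colourOf : Incidence (Torus m n) → Fin k
    colourOf ((v , _) , v~w) = colour v (direction v~w)

    proper : ∀ i j → DistinctInc (Torus m n) i j → IncAdj (Torus m n) i j → colourOf i ≢ colourOf j
    proper ((v₁ , w₁) , p₁) ((v₂ , w₂) , p₂) i≢j = proper′
      where
      d₁ d₂ : Dir
      d₁ = direction p₁
      d₂ = direction p₂
      w₁≡ : w₁ ≡ step d₁ v₁
      w₁≡ = step-direction p₁
      w₂≡ : w₂ ≡ step d₂ v₂
      w₂≡ = step-direction p₂
      i-enters-v₂ : v₂ ≡ w₁ → colour v₁ d₁ ≢ colour v₂ d₂
      i-enters-v₂ v₂≡w₁ e = distinct-along v₁ d₁ d₂ (trans e (cong (λ u → colour u d₂) (trans v₂≡w₁ w₁≡)))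
      j-enters-v₁ : v₁ ≡ w₂ → colour v₁ d₁ ≢ colour v₂ d₂
      j-enters-v₁ v₁≡w₂ e = distinct-along v₂ d₂ d₁ (trans (sym e) (cong (λ u → colour u d₁) (trans v₁≡w₂ w₂≡)))
      proper′ : IncAdj (Torus m n) ((v₁ , w₁) , p₁) ((v₂ , w₂) , p₂) → colour v₁ d₁ ≢ colour v₂ d₂
      proper′ (inj₁ refl) with d₁ ≟ d₂
      ... | yes d₁≡d₂ = ⊥-elim (i≢j (refl , inj₁ (refl , trans w₁≡ (trans (cong (λ d → step d v₁) d₁≡d₂) (sym w₂≡)))))
      ... | no  d₁≢d₂ = distinct-at v₁ d₁≢d₂
      proper′ (inj₂ (inj₁ (inj₁ (v₁≡v₂ , w₁≡w₂)))) = ⊥-elim (i≢j (v₁≡v₂ , inj₁ (v₁≡v₂ , w₁≡w₂)))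
      proper′ (inj₂ (inj₁ (inj₂ (_ , w₁≡v₂))))          = i-enters-v₂ (sym w₁≡v₂)
      proper′ (inj₂ (inj₂ (inj₁ (inj₁ (_ , v₂≡w₁)))))   = i-enters-v₂ v₂≡w₁
      proper′ (inj₂ (inj₂ (inj₁ (inj₂ (v₁≡w₁ , _)))))   = ⊥-elim (step-irreflexive d₁ v₁ (sym (trans v₁≡w₁ w₁≡)))
      proper′ (inj₂ (inj₂ (inj₂ (inj₁ (_ , v₂≡w₂)))))   = ⊥-elim (step-irreflexive d₂ v₂ (sym (trans v₂≡w₂ w₂≡)))
      proper′ (inj₂ (inj₂ (inj₂ (inj₂ (v₁≡w₂ , _)))))   = j-enters-v₁ v₁≡w₂

  toDirColouring : IncidenceColoring (Torus m n) k → DirColouring m n k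
  toDirColouring {k} (c , proper) = record
    { colour         = colour
    ; distinct-at    = distinct-at
    ; distinct-along = distinct-along
    }
    where
    colour : Fin m × Fin n → Dir → Fin k
    colour v d = c ((v , step d v) , step-adjacent d v)

    distinct-at : ∀ v {d d′} → d ≢ d′ → colour v d ≢ colour v d′
    distinct-at v {d} {d′} d≢d′ = proper _ _ different (inj₁ refl)
      where
      different : DistinctInc (Torus m n) ((v , step d v) , step-adjacent d v) ((v , step d′ v) , step-adjacent d′ v)
      different (_ , inj₁ (_ , e)) = d≢d′ (step-injective d d′ v e)
      different (_ , inj₂ (e , _)) = step-irreflexive d′ v (sym e)

    distinct-along : ∀ v d d′ → colour v d ≢ colour (step d v) d′
    distinct-along v d d′ = proper _ _ (step-irreflexive d v ∘ sym ∘ proj₁) (inj₂ (inj₂ (inj₁ (inj₁ (refl , refl)))))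

module _ (D : DirColouring m n k) where
  open DirColouring D

  outgoing : Fin m × Fin n → Vec (Fin k) 4
  outgoing u = colour u E ∷ colour u W ∷ colour u N ∷ colour u S ∷ []

  outgoing-unique : ∀ u → Unique (outgoing u)
  outgoing-unique u =
    (≢ (λ ()) ∷ ≢ (λ ()) ∷ ≢ (λ ()) ∷ []) ∷ (≢ (λ ()) ∷ ≢ (λ ()) ∷ []) ∷ (≢ (λ ()) ∷ []) ∷ [] ∷ []
    where
    ≢ : ∀ {d d′} → d ≢ d′ → colour u d ≢ colour u d′
    ≢ = distinct-at u

  incoming∉outgoing : ∀ w d → All (colour w d ≢_) (outgoing (step d w))
  incoming∉outgoing w d = along E ∷ along W ∷ along N ∷ along S ∷ []
    where
    along : ∀ d′ → colour w d ≢ colour (step d w) d′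
    along = distinct-along w d

  incoming∷outgoing-unique : ∀ w d → Unique (colour w d ∷ outgoing (step d w))
  incoming∷outgoing-unique w d = incoming∉outgoing w d ∷ outgoing-unique (step d w)

  at-least-five-colours : Fin m × Fin n → 5 ≤ k
  at-least-five-colours v = unique⇒length≤ (incoming∷outgoing-unique v E)

-- Perfect codes

Rainbow : (Fin m × Fin n → Fin k) → Set
Rainbow μ = ∀ v → Unique (μ v ∷ μ (step E v) ∷ μ (step W v) ∷ μ (step N v) ∷ μ (step S v) ∷ [])

rainbow-transpose : {μ : Fin m × Fin n → Fin k} → Rainbow μ → Rainbow (μ ∘ swap)
rainbow-transpose rainbow v = unique-transpose (rainbow (swap v))

module PerfectCode (μ : Fin m × Fin n → Fin 5) (rainbow : Rainbow μ) where

  private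
    R U : Fin m × Fin n → Fin m × Fin n
    R = step E
    U = step N

  at : Fin m × Fin n → ℕ → ℕ → Fin m × Fin n
  at b i j = fold (fold b U j) R i

  -- The colours on the closed neighbourhood of R (U p), listed as centre, E, W,
  -- N, S, with every point written through R and U only: points R^i U^j b for
  -- numerals i, j are then identified by normalisation.  The gap lemmas below
  -- are proved relative to a base point b south-west of the points involved.
  cross : Fin m × Fin n → Vec (Fin 5) 5
  cross p = μ (R (U p)) ∷ μ (R (R (U p))) ∷ μ (U p) ∷ μ (R (U (U p))) ∷ μ (R p) ∷ []

  cross-unique : ∀ p → Unique (cross p)
  cross-unique p =
    subst₂ (λ a b → Unique (μ (R (U p)) ∷ μ (R (R (U p))) ∷ μ a ∷ μ (R (U (U p))) ∷ μ b ∷ []))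
           (step-W-E (U p)) (step-S-N (R p)) (rainbow (R (U p)))

  apart : ∀ p (i j : Fin 5) → i ≢ j → lookup (cross p) i ≢ lookup (cross p) j
  apart p i j i≢j = i≢j ∘ lookup-injective (cross-unique p) i j

  forced-N : ∀ p {a} → μ (R (U p)) ≢ a → μ (R (R (U p))) ≢ a → μ (U p) ≢ a → μ (R p) ≢ a →
             μ (R (U (U p))) ≡ a
  forced-N p {a} ≢0 ≢1 ≢2 ≢4 with unique⇒∈ (cross-unique p) a
  ... | here e                                 = contradiction (sym e) ≢0
  ... | there (here e)                         = contradiction (sym e) ≢1
  ... | there (there (here e))                 = contradiction (sym e) ≢2
  ... | there (there (there (here e)))         = sym e
  ... | there (there (there (there (here e)))) = contradiction (sym e) ≢4

  forced-S : ∀ p {a} → μ (R (U p)) ≢ a → μ (R (R (U p))) ≢ a → μ (U p) ≢ a → μ (R (U (U p))) ≢ a →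
             μ (R p) ≡ a
  forced-S p {a} ≢0 ≢1 ≢2 ≢3 with unique⇒∈ (cross-unique p) a
  ... | here e                                 = contradiction (sym e) ≢0
  ... | there (here e)                         = contradiction (sym e) ≢1
  ... | there (there (here e))                 = contradiction (sym e) ≢2
  ... | there (there (there (here e)))         = contradiction (sym e) ≢3
  ... | there (there (there (there (here e)))) = sym e

  private
    retarget : {x a b : Fin 5} → x ≢ b → a ≡ b → x ≢ a
    retarget x≢b a≡b x≡a = x≢b (trans x≡a a≡b)

  gap₁-at : ∀ b → μ (at b 1 3) ≢ μ (at b 2 3)
  gap₁-at b = apart (at b 1 2) 2F 0F λ ()

  gap₂-at : ∀ b → μ (at b 1 3) ≢ μ (at b 3 3)
  gap₂-at b = apart (at b 1 2) 2F 1F λ ()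

  -- If a = μ (at b 1 3) recurred 3 (or 4) steps east, the fact that a occurs in
  -- every closed neighbourhood would force two occurrences of a at distance ≤ 2.
  gap₃-at : ∀ b → μ (at b 1 3) ≢ μ (at b 4 3)
  gap₃-at b h = apart (at b 1 4) 0F 1F (λ ()) (trans f₁ (sym f₂))
    where
    μ24≢ : μ (at b 2 4) ≢ μ (at b 1 3)
    μ24≢ = apart (at b 1 2) 3F 2F λ ()
    μ34≢ : μ (at b 3 4) ≢ μ (at b 1 3)
    μ34≢ = retarget (apart (at b 2 2) 3F 1F λ ()) h
    f₁ : μ (at b 2 5) ≡ μ (at b 1 3)
    f₁ = forced-N (at b 1 3) μ24≢ μ34≢ (apart (at b 0 2) 3F 0F λ ()) (apart (at b 1 2) 0F 2F λ ())
    f₂ : μ (at b 3 5) ≡ μ (at b 1 3)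
    f₂ = forced-N (at b 2 3) μ34≢ (retarget (apart (at b 3 2) 3F 0F λ ()) h) μ24≢
                  (retarget (apart (at b 2 2) 0F 1F λ ()) h)

  gap₄-north : ∀ b → μ (at b 1 3) ≡ μ (at b 5 3) → μ (at b 1 3) ≢ μ (at b 3 4)
  gap₄-north b h h↑ = apart (at b 2 0) 2F 1F (λ ()) (trans f₁ (sym f₂))
    where
    μ32≢ : μ (at b 3 2) ≢ μ (at b 1 3)
    μ32≢ = retarget (apart (at b 2 2) 4F 3F λ ()) h↑
    f₁ : μ (at b 2 1) ≡ μ (at b 1 3)
    f₁ = forced-S (at b 1 1) (apart (at b 1 2) 4F 2F λ ()) μ32≢ (apart (at b 0 1) 0F 3F λ ())
                  (apart (at b 1 2) 0F 2F λ ())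
    f₂ : μ (at b 4 1) ≡ μ (at b 1 3)
    f₂ = forced-S (at b 3 1) (retarget (apart (at b 3 2) 4F 1F λ ()) h) (retarget (apart (at b 4 1) 0F 3F λ ()) h)
                  μ32≢ (retarget (apart (at b 3 2) 0F 1F λ ()) h)

  gap₄-south : ∀ b → μ (at b 1 3) ≡ μ (at b 5 3) → μ (at b 1 3) ≢ μ (at b 3 2)
  gap₄-south b h h↓ = apart (at b 2 4) 2F 1F (λ ()) (trans f₁ (sym f₂))
    where
    μ34≢ : μ (at b 3 4) ≢ μ (at b 1 3)
    μ34≢ = retarget (apart (at b 2 2) 3F 4F λ ()) h↓
    f₁ : μ (at b 2 5) ≡ μ (at b 1 3)
    f₁ = forced-N (at b 1 3) (apart (at b 1 2) 3F 2F λ ()) μ34≢ (apart (at b 0 2) 3F 0F λ ())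
                  (apart (at b 1 2) 0F 2F λ ())
    f₂ : μ (at b 4 5) ≡ μ (at b 1 3)
    f₂ = forced-N (at b 3 3) (retarget (apart (at b 3 2) 3F 1F λ ()) h) (retarget (apart (at b 4 2) 3F 0F λ ()) h)
                  μ34≢ (retarget (apart (at b 3 2) 0F 1F λ ()) h)

  gap₄-at : ∀ b → μ (at b 1 3) ≢ μ (at b 5 3)
  gap₄-at b h with unique⇒∈ (cross-unique (at b 2 2)) (μ (at b 1 3))
  ... | here e                                 = gap₂-at b e
  ... | there (here e)                         = apart (at b 3 2) 0F 1F (λ ()) (trans (sym e) h)
  ... | there (there (here e))                 = gap₁-at b e
  ... | there (there (there (here e)))         = gap₄-north b h e
  ... | there (there (there (there (here e)))) = gap₄-south b h e

  corner : Fin m × Fin n → Fin m × Fin n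
  corner w = step W (step S (step S (step S w)))

  at-corner : ∀ w → at (corner w) 1 3 ≡ w
  at-corner (x , y) = cong₂ _,_ (next-prev x) (begin
    next (next (next (prev (prev (prev y))))) ≡⟨ cong (next ∘ next) (next-prev (prev (prev y))) ⟩
    next (next (prev (prev y)))               ≡⟨ cong next (next-prev (prev y)) ⟩
    next (prev y)                             ≡⟨ next-prev y ⟩
    y                                         ∎)
    where open ≡-Reasoning

  recentred : ∀ {k} → (∀ b → μ (at b 1 3) ≢ μ (fold (at b 1 3) R k)) → ∀ w → μ w ≢ μ (fold w R k)
  recentred {k} gap w = subst (λ v → μ v ≢ μ (fold v R k)) (at-corner w) (gap (corner w))

  gap₁ : ∀ w → μ w ≢ μ (R w)
  gap₁ = recentred {1} gap₁-at

  gap₂ : ∀ w → μ w ≢ μ (R (R w))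
  gap₂ = recentred {2} gap₂-at

  gap₃ : ∀ w → μ w ≢ μ (R (R (R w)))
  gap₃ = recentred {3} gap₃-at

  gap₄ : ∀ w → μ w ≢ μ (R (R (R (R w))))
  gap₄ = recentred {4} gap₄-at

  window-unique : ∀ w → Unique (μ w ∷ μ (R w) ∷ μ (R (R w)) ∷ μ (R (R (R w))) ∷ μ (R (R (R (R w)))) ∷ [])
  window-unique w =
      (gap₁ w ∷ gap₂ w ∷ gap₃ w ∷ gap₄ w ∷ [])
    ∷ (gap₁ (R w) ∷ gap₂ (R w) ∷ gap₃ (R w) ∷ [])
    ∷ (gap₁ (R (R w)) ∷ gap₂ (R (R w)) ∷ [])
    ∷ (gap₁ (R (R (R w))) ∷ [])
    ∷ []
    ∷ []

  period-5 : ∀ w → μ (fold w R 5) ≡ μ w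
  period-5 w with unique⇒∈ (window-unique w) (μ (fold w R 5))
  ... | here e                                 = e
  ... | there (here e)                         = contradiction (sym e) (gap₄ (R w))
  ... | there (there (here e))                 = contradiction (sym e) (gap₃ (R (R w)))
  ... | there (there (there (here e)))         = contradiction (sym e) (gap₂ (R (R (R w))))
  ... | there (there (there (there (here e)))) = contradiction (sym e) (gap₁ (R (R (R (R w)))))

  period-multiple-5 : ∀ q w → μ (fold w R (q * 5)) ≡ μ w
  period-multiple-5 zero    w = refl
  period-multiple-5 (suc q) w = begin
    μ (fold w R (5 + q * 5))           ≡⟨ cong μ (fold-+ w R 5 {q * 5}) ⟩
    μ (fold (fold w R (q * 5)) R 5)    ≡⟨ period-5 (fold w R (q * 5)) ⟩
    μ (fold w R (q * 5))               ≡⟨ period-multiple-5 q w ⟩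
    μ w                                ∎
    where open ≡-Reasoning

  return-within-5⇒0 : ∀ w r → r < 5 → μ (fold w R r) ≡ μ w → r ≡ 0
  return-within-5⇒0 w 0 _ _ = refl
  return-within-5⇒0 w 1 _ e = contradiction (sym e) (gap₁ w)
  return-within-5⇒0 w 2 _ e = contradiction (sym e) (gap₂ w)
  return-within-5⇒0 w 3 _ e = contradiction (sym e) (gap₃ w)
  return-within-5⇒0 w 4 _ e = contradiction (sym e) (gap₄ w)
  return-within-5⇒0 w (suc (suc (suc (suc (suc _))))) (s≤s (s≤s (s≤s (s≤s (s≤s ()))))) _

  fold-R-length : (w : Fin m × Fin n) → fold w R m ≡ w
  fold-R-length (x , y) = trans (fold-R x m) (cong (_, y) (fold-next-length x))
    where
    fold-R : ∀ x t → fold (x , y) R t ≡ (fold x next t , y)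
    fold-R x zero    = refl
    fold-R x (suc t) = cong R (fold-R x t)

  m%5≡0 : Fin m × Fin n → m % 5 ≡ 0
  m%5≡0 w = return-within-5⇒0 w (m % 5) (m%n<n m 5) (begin
    μ (fold w R (m % 5))                      ≡⟨ period-multiple-5 (m / 5) (fold w R (m % 5)) ⟨
    μ (fold (fold w R (m % 5)) R (m / 5 * 5)) ≡⟨ cong μ (fold-+ w R (m / 5 * 5) {m % 5}) ⟨
    μ (fold w R (m / 5 * 5 + m % 5))          ≡⟨ cong (μ ∘ fold w R) (+-comm (m / 5 * 5) (m % 5)) ⟩
    μ (fold w R (m % 5 + m / 5 * 5))          ≡⟨ cong (μ ∘ fold w R) (m≡m%n+[m/n]*n m 5) ⟨
    μ (fold w R m)                            ≡⟨ cong μ (fold-R-length w) ⟩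
    μ w                                       ∎)
    where open ≡-Reasoning

module FiveColouring (D : DirColouring m n 5) where
  open DirColouring D

  incoming-colour : ∀ w d w′ d′ → step d w ≡ step d′ w′ → colour w d ≡ colour w′ d′
  incoming-colour w d w′ d′ e with unique⇒∈ (incoming∷outgoing-unique D w d) (colour w′ d′)
  ... | here e′   = sym e′
  ... | there out = contradiction refl
    (All.lookup (subst (λ u → All (colour w′ d′ ≢_) (outgoing D u)) (sym e) (incoming∉outgoing D w′ d′)) out)

  missing : Fin m × Fin n → Fin 5
  missing u = colour (step W u) E

  colour≡missing : ∀ w d → colour w d ≡ missing (step d w)
  colour≡missing w d = incoming-colour w d (step W (step d w)) E (sym (step-E-W (step d w)))

  missing≢neighbour : ∀ w d → missing w ≢ missing (step d w)
  missing≢neighbour w d e = distinct-along (step W w) E d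
    (trans e (trans (sym (colour≡missing w d)) (cong (λ v → colour v d) (sym (step-E-W w)))))

  neighbours≢ : ∀ w d d′ → d ≢ d′ → missing (step d w) ≢ missing (step d′ w)
  neighbours≢ w d d′ d≢d′ e = distinct-at w d≢d′ (trans (colour≡missing w d) (trans e (sym (colour≡missing w d′))))

  missing-rainbow : Rainbow missing
  missing-rainbow w =
      (c E ∷ c W ∷ c N ∷ c S ∷ [])
    ∷ (≢ E W (λ ()) ∷ ≢ E N (λ ()) ∷ ≢ E S (λ ()) ∷ [])
    ∷ (≢ W N (λ ()) ∷ ≢ W S (λ ()) ∷ [])
    ∷ (≢ N S (λ ()) ∷ [])
    ∷ []
    ∷ []
    where
    c : ∀ d → missing w ≢ missing (step d w)
    c = missing≢neighbour w
    ≢ : ∀ d d′ → d ≢ d′ → missing (step d w) ≢ missing (step d′ w)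
    ≢ = neighbours≢ w

-- Periodic colourings

ClosedWalk : ∀ {a} → (Fin a → Fin a → Bool) → ℕ → Set
ClosedWalk {a} _⇢_ m = ∃ λ (τ : Fin m → Fin a) → ∀ x → T (τ x ⇢ τ (next x))

closed-walk : ∀ {a} {_⇢_ : Fin a → Fin a → Bool} (f : ℕ → Fin a) →
  (∀ j → suc j < m → T (f j ⇢ f (suc j))) → (∀ j → suc j ≡ m → T (f j ⇢ f 0)) → ClosedWalk _⇢_ m
closed-walk {m} {_⇢_ = _⇢_} f steps wrap = f ∘ toℕ , walk
  where
  walk : ∀ x → T (f (toℕ x) ⇢ f (toℕ (next x)))
  walk x with Succ-next x
  ... | inj₁ e       = subst (λ j → T (f (toℕ x) ⇢ f j)) e (steps (toℕ x) (subst (_< m) (sym e) (toℕ<n (next x))))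
  ... | inj₂ (e , z) = subst (λ j → T (f (toℕ x) ⇢ f j)) (sym z) (wrap (toℕ x) e)

mod-walk : ∀ d .{{_ : NonZero d}} → m % d ≡ 0 → ClosedWalk (λ s s′ → ⌊ s′ ≟ next s ⌋) m
mod-walk {m} d m%d≡0 = (λ x → toℕ x mod d) , λ x → fromWitness (toℕ-injective (commutes x))
  where
  commutes : (x : Fin m) → toℕ (toℕ (next x) mod d) ≡ toℕ (next (toℕ x mod d))
  commutes x = begin
    toℕ (toℕ (next x) mod d)    ≡⟨ toℕ-fromℕ< _ ⟩
    toℕ (next x) % d            ≡⟨ next-% x ⟩
    suc (toℕ x) % d             ≡⟨ suc-%-absorb (toℕ x) d ⟨
    suc (toℕ x % d) % d         ≡⟨ cong (λ i → suc i % d) (toℕ-fromℕ< _) ⟨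
    suc (toℕ (toℕ x mod d)) % d ≡⟨ toℕ-next (toℕ x mod d) ⟨
    toℕ (next (toℕ x mod d))    ∎
    where
    open ≡-Reasoning
    next-% : (x : Fin m) → toℕ (next x) % d ≡ suc (toℕ x) % d
    next-% x with Succ-next x
    ... | inj₁ e       = cong (_% d) (sym e)
    ... | inj₂ (e , z) = trans (cong (_% d) z) (trans (m*n%n≡0 0 d) (sym (trans (cong (_% d) e) m%d≡0)))

-- tile s t d colours the incidence in direction d at a vertex of column type s
-- and row type t; right and up say which types may follow each other.
record Pattern (a b k : ℕ) : Set where
  field
    tile  : Fin a → Fin b → Dir → Fin k
    right : Fin a → Fin a → Bool
    up    : Fin b → Fin b → Bool

  ProperAt : Set
  ProperAt = ∀ s t d d′ → d ≢ d′ → tile s t d ≢ tile s t d′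

  ProperRight : Set
  ProperRight = ∀ s s′ → T (right s s′) → ∀ t d → tile s t E ≢ tile s′ t d × tile s′ t W ≢ tile s t d

  ProperUp : Set
  ProperUp = ∀ t t′ → T (up t t′) → ∀ s d → tile s t N ≢ tile s t′ d × tile s t′ S ≢ tile s t d

  Proper : Set
  Proper = ProperAt × ProperRight × ProperUp

  proper? : Dec Proper
  proper? =
        (all? λ s → all? λ t → all? λ d → all? λ d′ → ¬? (d ≟ d′) →-dec ¬? (tile s t d ≟ tile s t d′))
    ×-dec (all? λ s → all? λ s′ → T? (right s s′) →-dec all? λ t → all? λ d →
             ¬? (tile s t E ≟ tile s′ t d) ×-dec ¬? (tile s′ t W ≟ tile s t d))
    ×-dec (all? λ t → all? λ t′ → T? (up t t′) →-dec all? λ s → all? λ d →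
             ¬? (tile s t N ≟ tile s t′ d) ×-dec ¬? (tile s t′ S ≟ tile s t d))

patternColouring : ∀ {m n k a b} (P : Pattern a b k) → Pattern.Proper P →
  ClosedWalk (Pattern.right P) m → ClosedWalk (Pattern.up P) n → DirColouring m n k
patternColouring {m} {n} {k} P (proper-at , proper-right , proper-up) (τ , τ-walk) (σ , σ-walk) = record
  { colour         = colour
  ; distinct-at    = λ { (x , y) → proper-at (τ x) (σ y) _ _ }
  ; distinct-along = distinct-along
  }
  where
  open Pattern P using (tile; right; up)
  colour : Fin m × Fin n → Dir → Fin k
  colour (x , y) = tile (τ x) (σ y)

  distinct-along : ∀ v d d′ → colour v d ≢ colour (step d v) d′
  distinct-along (x , y) E d′ = proj₁ (proper-right (τ x) (τ (next x)) (τ-walk x) (σ y) d′)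
  distinct-along (x , y) W d′ = proj₂ (proper-right (τ (prev x)) (τ x) τ-walk′ (σ y) d′)
    where
    τ-walk′ : T (right (τ (prev x)) (τ x))
    τ-walk′ = subst (λ z → T (right (τ (prev x)) (τ z))) (next-prev x) (τ-walk (prev x))
  distinct-along (x , y) N d′ = proj₁ (proper-up (σ y) (σ (next y)) (σ-walk y) (τ x) d′)
  distinct-along (x , y) S d′ = proj₂ (proper-up (σ (prev y)) (σ y) σ-walk′ (τ x) d′)
    where
    σ-walk′ : T (up (σ (prev y)) (σ y))
    σ-walk′ = subst (λ z → T (up (σ (prev y)) (σ z))) (next-prev y) (σ-walk (prev y))

-- A perfect code of C₅ □ C₅: every closed neighbourhood meets each colour once.
code : Fin 5 × Fin 5 → Fin 5
code (s , t) = (toℕ s + 2 * toℕ t) mod 5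

pattern₅ : Pattern 5 5 5
pattern₅ = record
  { tile  = λ s t d → code (step d (s , t))
  ; right = λ s s′ → ⌊ s′ ≟ next s ⌋
  ; up    = λ t t′ → ⌊ t′ ≟ next t ⌋
  }

pattern₅-proper : Pattern.Proper pattern₅
pattern₅-proper = from-yes (Pattern.proper? pattern₅)

tiles₆ : Dir → Vec (Vec (Fin 6) 10) 10
tiles₆ E =
      (# 2 ∷ # 1 ∷ # 4 ∷ # 5 ∷ # 1 ∷ # 4 ∷ # 4 ∷ # 1 ∷ # 0 ∷ # 4 ∷ [])
    ∷ (# 3 ∷ # 2 ∷ # 0 ∷ # 4 ∷ # 5 ∷ # 0 ∷ # 2 ∷ # 5 ∷ # 2 ∷ # 0 ∷ [])
    ∷ (# 1 ∷ # 4 ∷ # 2 ∷ # 0 ∷ # 4 ∷ # 1 ∷ # 1 ∷ # 3 ∷ # 4 ∷ # 2 ∷ [])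
    ∷ (# 3 ∷ # 0 ∷ # 5 ∷ # 4 ∷ # 0 ∷ # 2 ∷ # 3 ∷ # 5 ∷ # 2 ∷ # 5 ∷ [])
    ∷ (# 4 ∷ # 3 ∷ # 1 ∷ # 2 ∷ # 5 ∷ # 1 ∷ # 0 ∷ # 2 ∷ # 1 ∷ # 0 ∷ [])
    ∷ (# 1 ∷ # 4 ∷ # 2 ∷ # 3 ∷ # 2 ∷ # 3 ∷ # 1 ∷ # 3 ∷ # 5 ∷ # 2 ∷ [])
    ∷ (# 0 ∷ # 5 ∷ # 1 ∷ # 4 ∷ # 3 ∷ # 1 ∷ # 2 ∷ # 5 ∷ # 2 ∷ # 1 ∷ [])
    ∷ (# 4 ∷ # 4 ∷ # 5 ∷ # 1 ∷ # 4 ∷ # 0 ∷ # 1 ∷ # 0 ∷ # 0 ∷ # 5 ∷ [])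
    ∷ (# 5 ∷ # 3 ∷ # 1 ∷ # 3 ∷ # 5 ∷ # 1 ∷ # 3 ∷ # 5 ∷ # 3 ∷ # 2 ∷ [])
    ∷ (# 1 ∷ # 0 ∷ # 3 ∷ # 0 ∷ # 2 ∷ # 3 ∷ # 0 ∷ # 3 ∷ # 5 ∷ # 3 ∷ [])
  ∷ []
tiles₆ W =
      (# 4 ∷ # 2 ∷ # 1 ∷ # 2 ∷ # 5 ∷ # 0 ∷ # 2 ∷ # 5 ∷ # 1 ∷ # 0 ∷ [])
    ∷ (# 1 ∷ # 4 ∷ # 2 ∷ # 3 ∷ # 4 ∷ # 3 ∷ # 1 ∷ # 2 ∷ # 5 ∷ # 2 ∷ [])
    ∷ (# 5 ∷ # 0 ∷ # 4 ∷ # 5 ∷ # 3 ∷ # 2 ∷ # 0 ∷ # 1 ∷ # 3 ∷ # 4 ∷ [])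
    ∷ (# 1 ∷ # 4 ∷ # 2 ∷ # 0 ∷ # 2 ∷ # 3 ∷ # 0 ∷ # 2 ∷ # 5 ∷ # 2 ∷ [])
    ∷ (# 0 ∷ # 5 ∷ # 3 ∷ # 5 ∷ # 1 ∷ # 4 ∷ # 5 ∷ # 1 ∷ # 3 ∷ # 4 ∷ [])
    ∷ (# 3 ∷ # 1 ∷ # 4 ∷ # 1 ∷ # 3 ∷ # 2 ∷ # 3 ∷ # 4 ∷ # 0 ∷ # 5 ∷ [])
    ∷ (# 1 ∷ # 0 ∷ # 2 ∷ # 0 ∷ # 2 ∷ # 3 ∷ # 1 ∷ # 2 ∷ # 5 ∷ # 3 ∷ [])
    ∷ (# 2 ∷ # 3 ∷ # 4 ∷ # 3 ∷ # 0 ∷ # 4 ∷ # 4 ∷ # 1 ∷ # 3 ∷ # 4 ∷ [])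
    ∷ (# 3 ∷ # 5 ∷ # 3 ∷ # 5 ∷ # 2 ∷ # 5 ∷ # 5 ∷ # 3 ∷ # 2 ∷ # 3 ∷ [])
    ∷ (# 2 ∷ # 4 ∷ # 5 ∷ # 1 ∷ # 4 ∷ # 2 ∷ # 1 ∷ # 0 ∷ # 0 ∷ # 5 ∷ [])
  ∷ []
tiles₆ N =
      (# 0 ∷ # 3 ∷ # 5 ∷ # 4 ∷ # 3 ∷ # 5 ∷ # 3 ∷ # 4 ∷ # 3 ∷ # 1 ∷ [])
    ∷ (# 0 ∷ # 3 ∷ # 5 ∷ # 1 ∷ # 2 ∷ # 5 ∷ # 3 ∷ # 0 ∷ # 4 ∷ # 5 ∷ [])
    ∷ (# 2 ∷ # 1 ∷ # 3 ∷ # 1 ∷ # 0 ∷ # 4 ∷ # 5 ∷ # 2 ∷ # 5 ∷ # 3 ∷ [])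
    ∷ (# 5 ∷ # 3 ∷ # 0 ∷ # 1 ∷ # 4 ∷ # 0 ∷ # 1 ∷ # 3 ∷ # 4 ∷ # 0 ∷ [])
    ∷ (# 1 ∷ # 4 ∷ # 2 ∷ # 0 ∷ # 2 ∷ # 3 ∷ # 4 ∷ # 0 ∷ # 5 ∷ # 3 ∷ [])
    ∷ (# 2 ∷ # 0 ∷ # 5 ∷ # 0 ∷ # 1 ∷ # 4 ∷ # 5 ∷ # 1 ∷ # 3 ∷ # 4 ∷ [])
    ∷ (# 3 ∷ # 4 ∷ # 5 ∷ # 1 ∷ # 4 ∷ # 2 ∷ # 0 ∷ # 3 ∷ # 4 ∷ # 2 ∷ [])
    ∷ (# 5 ∷ # 1 ∷ # 0 ∷ # 2 ∷ # 1 ∷ # 3 ∷ # 3 ∷ # 4 ∷ # 1 ∷ # 0 ∷ [])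
    ∷ (# 1 ∷ # 0 ∷ # 2 ∷ # 4 ∷ # 0 ∷ # 4 ∷ # 0 ∷ # 1 ∷ # 5 ∷ # 4 ∷ [])
    ∷ (# 3 ∷ # 1 ∷ # 4 ∷ # 5 ∷ # 1 ∷ # 4 ∷ # 5 ∷ # 1 ∷ # 2 ∷ # 4 ∷ [])
  ∷ []
tiles₆ S =
      (# 3 ∷ # 5 ∷ # 0 ∷ # 1 ∷ # 0 ∷ # 2 ∷ # 5 ∷ # 0 ∷ # 2 ∷ # 5 ∷ [])
    ∷ (# 4 ∷ # 5 ∷ # 1 ∷ # 2 ∷ # 0 ∷ # 1 ∷ # 5 ∷ # 4 ∷ # 1 ∷ # 3 ∷ [])
    ∷ (# 0 ∷ # 3 ∷ # 5 ∷ # 3 ∷ # 2 ∷ # 5 ∷ # 3 ∷ # 4 ∷ # 0 ∷ # 1 ∷ [])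
    ∷ (# 4 ∷ # 2 ∷ # 1 ∷ # 2 ∷ # 3 ∷ # 1 ∷ # 2 ∷ # 4 ∷ # 1 ∷ # 3 ∷ [])
    ∷ (# 5 ∷ # 2 ∷ # 0 ∷ # 3 ∷ # 4 ∷ # 0 ∷ # 2 ∷ # 3 ∷ # 4 ∷ # 2 ∷ [])
    ∷ (# 0 ∷ # 5 ∷ # 3 ∷ # 5 ∷ # 4 ∷ # 5 ∷ # 4 ∷ # 0 ∷ # 2 ∷ # 1 ∷ [])
    ∷ (# 4 ∷ # 2 ∷ # 3 ∷ # 2 ∷ # 5 ∷ # 0 ∷ # 5 ∷ # 4 ∷ # 1 ∷ # 0 ∷ [])
    ∷ (# 1 ∷ # 0 ∷ # 2 ∷ # 0 ∷ # 5 ∷ # 2 ∷ # 0 ∷ # 2 ∷ # 5 ∷ # 2 ∷ [])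
    ∷ (# 0 ∷ # 2 ∷ # 4 ∷ # 2 ∷ # 1 ∷ # 3 ∷ # 4 ∷ # 2 ∷ # 4 ∷ # 1 ∷ [])
    ∷ (# 0 ∷ # 5 ∷ # 2 ∷ # 4 ∷ # 3 ∷ # 5 ∷ # 4 ∷ # 2 ∷ # 4 ∷ # 1 ∷ [])
  ∷ []
-- The ten column (and row) types form three cycles through type 0, of
-- lengths 3, 4 and 5.
edge₆ : ℕ → ℕ → Bool
edge₆ 0 1 = true
edge₆ 1 2 = true
edge₆ 2 0 = true
edge₆ 0 3 = true
edge₆ 3 4 = true
edge₆ 4 5 = true
edge₆ 5 0 = true
edge₆ 0 6 = true
edge₆ 6 7 = true
edge₆ 7 8 = true
edge₆ 8 9 = true
edge₆ 9 0 = true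
edge₆ _ _ = false

_⇢₆_ : Fin 10 → Fin 10 → Bool
s ⇢₆ s′ = edge₆ (toℕ s) (toℕ s′)

pattern₆ : Pattern 10 10 6
pattern₆ = record
  { tile  = λ s t d → lookup (lookup (tiles₆ d) s) t
  ; right = _⇢₆_
  ; up    = _⇢₆_
  }

pattern₆-proper : Pattern.Proper pattern₆
pattern₆-proper = from-yes (Pattern.proper? pattern₆)

-- walk₆ k is a closed walk of length 3 + k: 3, 4 or 5 for k < 3, and the
-- 3-cycle followed by walk₆ (k - 3) otherwise.
walk₆ : ℕ → ℕ → Fin 10
walk₆ 0 0 = # 0
walk₆ 0 1 = # 1
walk₆ 0 _ = # 2
walk₆ 1 0 = # 0
walk₆ 1 1 = # 3
walk₆ 1 2 = # 4
walk₆ 1 _ = # 5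
walk₆ 2 0 = # 0
walk₆ 2 1 = # 6
walk₆ 2 2 = # 7
walk₆ 2 3 = # 8
walk₆ 2 _ = # 9
walk₆ (suc (suc (suc k))) 0 = # 0
walk₆ (suc (suc (suc k))) 1 = # 1
walk₆ (suc (suc (suc k))) 2 = # 2
walk₆ (suc (suc (suc k))) (suc (suc (suc j))) = walk₆ k j

walk₆-start : ∀ k → walk₆ k 0 ≡ # 0
walk₆-start 0 = refl
walk₆-start 1 = refl
walk₆-start 2 = refl
walk₆-start (suc (suc (suc k))) = refl

walk₆-step : ∀ k j → suc j < 3 + k → T (walk₆ k j ⇢₆ walk₆ k (suc j))
walk₆-step 0 0 _ = _
walk₆-step 0 1 _ = _
walk₆-step 0 (suc (suc j)) (s≤s (s≤s (s≤s ())))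
walk₆-step 1 0 _ = _
walk₆-step 1 1 _ = _
walk₆-step 1 2 _ = _
walk₆-step 1 (suc (suc (suc j))) (s≤s (s≤s (s≤s (s≤s ()))))
walk₆-step 2 0 _ = _
walk₆-step 2 1 _ = _
walk₆-step 2 2 _ = _
walk₆-step 2 3 _ = _
walk₆-step 2 (suc (suc (suc (suc j)))) (s≤s (s≤s (s≤s (s≤s (s≤s ())))))
walk₆-step (suc (suc (suc k))) 0 _ = _
walk₆-step (suc (suc (suc k))) 1 _ = _
walk₆-step (suc (suc (suc k))) 2 _ = subst (λ i → T ((# 2) ⇢₆ i)) (sym (walk₆-start k)) _
walk₆-step (suc (suc (suc k))) (suc (suc (suc j))) (s≤s (s≤s (s≤s j<k))) = walk₆-step k j j<k

walk₆-close : ∀ k j → suc j ≡ 3 + k → T (walk₆ k j ⇢₆ walk₆ k 0)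
walk₆-close 0 2 refl = _
walk₆-close 1 3 refl = _
walk₆-close 2 4 refl = _
walk₆-close (suc (suc (suc k))) (suc (suc (suc j))) e =
  subst (λ i → T (walk₆ k j ⇢₆ i)) (walk₆-start k) (walk₆-close k j (suc-injective (suc-injective (suc-injective e))))

closed-walk₆ : 3 ≤ m → ClosedWalk _⇢₆_ m
closed-walk₆ (s≤s (s≤s (s≤s {n = k} _))) = closed-walk {_⇢_ = _⇢₆_} (walk₆ k) (walk₆-step k) (walk₆-close k)

theorem1 : ∀ (m n : ℕ) → 3 ≤ m → 3 ≤ n →
    ((m % 5 ≡ 0 × n % 5 ≡ 0) → IncChromaticNumber (Torus m n) 5) ×
    (¬ (m % 5 ≡ 0 × n % 5 ≡ 0) → IncChromaticNumber (Torus m n) 6)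
theorem1 m n 3≤m 3≤n = five , six
  where
  v₀ : Fin m × Fin n
  v₀ = fromℕ< 3≤m , fromℕ< 3≤n

  ≥5 : ∀ j → IncidenceColoring (Torus m n) j → 5 ≤ j
  ≥5 _ c = at-least-five-colours (toDirColouring 3≤m 3≤n c) v₀

  5-colourable⇒5∣ : IncidenceColoring (Torus m n) 5 → m % 5 ≡ 0 × n % 5 ≡ 0
  5-colourable⇒5∣ c =
      PerfectCode.m%5≡0 missing missing-rainbow v₀
    , PerfectCode.m%5≡0 (missing ∘ swap) (rainbow-transpose missing-rainbow) (swap v₀)
    where open FiveColouring (toDirColouring 3≤m 3≤n c)

  five : m % 5 ≡ 0 × n % 5 ≡ 0 → IncChromaticNumber (Torus m n) 5
  five (m%5≡0 , n%5≡0) =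
      fromDirColouring 3≤m 3≤n
        (patternColouring pattern₅ pattern₅-proper (mod-walk 5 m%5≡0) (mod-walk 5 n%5≡0))
    , λ j j<5 c → <⇒≱ j<5 (≥5 j c)

  six : ¬ (m % 5 ≡ 0 × n % 5 ≡ 0) → IncChromaticNumber (Torus m n) 6
  six ¬5∣ =
      fromDirColouring 3≤m 3≤n
        (patternColouring pattern₆ pattern₆-proper (closed-walk₆ 3≤m) (closed-walk₆ 3≤n))
    , λ j j<6 c → case m<1+n⇒m<n∨m≡n j<6 of λ
        { (inj₁ j<5)  → <⇒≱ j<5 (≥5 j c)
        ; (inj₂ refl) → ¬5∣ (5-colourable⇒5∣ c) }
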